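{- If $G$ is a graph with maximum degree $\Delta(G)$, then $$\chi_{\rho}(G)\ge \Delta(G)-\alpha(G)+2.$$ Moreover, equality holds if $\Delta(G)=n(G)-1$.
   Context: All graphs are finite and simple; $n(G)$ is the number of vertices, $\alpha(G)$ the independence number and $\Delta(G)$ the maximum degree of $G$. For a positive integer $i$, an $i$-packing in $G$ is a set $W\subseteq V(G)$ such that any two distinct vertices of $W$ are at distance greater than $i$ in $G$. The packing chromatic number $\chi_{\rho}(G)$ is the smallest integer $k$ such that $V(G)$ can be partitioned into sets $V_1,\dots,V_k$ with $V_i$ an $i$-packing for each $i\in\{1,\dots,k\}$. -}

module Defs where

open import Data.Nat using (ℕ; zero; suc; _+_; _≤_)
open import Data.Bool using (Bool; true; false)
open import Data.Fin using (Fin; toℕ; _≟_)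
open import Relation.Nullary.Decidable using (⌊_⌋)
open import Data.Fin.Subset using (Subset; _∈_; ∣_∣)
open import Data.Vec using (tabulate)
open import Data.Product using (Σ; _×_; ∃)
open import Relation.Binary.PropositionalEquality using (_≡_)
open import Relation.Nullary using (¬_)

record Graph (n : ℕ) : Set where
  field
    adj   : Fin n → Fin n → Bool
    sym   : ∀ u v → adj u v ≡ adj v u
    irrefl : ∀ v → adj v v ≡ false
open Graph public

Adj : ∀ {n} → Graph n → Fin n → Fin n → Set
Adj G u v = adj G u v ≡ true

Walk : ∀ {n} → Graph n → ℕ → Fin n → Fin n → Set
Walk G zero    u v = u ≡ v
Walk G (suc k) u v = Σ _ λ w → Adj G u w × Walk G k w v

DistLe : ∀ {n} → Graph n → Fin n → Fin n → ℕ → Set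
DistLe G u v i = Σ ℕ λ k → k ≤ i × Walk G k u v

IsPacking : ∀ {n} → Graph n → ℕ → Subset n → Set
IsPacking G i W = ∀ u v → u ∈ W → v ∈ W → ¬ (u ≡ v) → ¬ DistLe G u v i

-- Partition of V(G) into V_1,…,V_k with V_i an i-packing, given as the map
-- c : V(G) → Fin k sending a vertex to (index of its class) - 1.
classOf : ∀ {n k} → (Fin n → Fin k) → Fin k → Subset n
classOf c j = tabulate λ v → ⌊ c v ≟ j ⌋

IsPackingColoring : ∀ {n k} → Graph n → (Fin n → Fin k) → Set
IsPackingColoring G c = ∀ j → IsPacking G (suc (toℕ j)) (classOf c j)

HasPackingColoring : ∀ {n} → Graph n → ℕ → Set
HasPackingColoring {n} G k = Σ (Fin n → Fin k) λ c → IsPackingColoring G c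

IsPackingChromaticNumber : ∀ {n} → Graph n → ℕ → Set
IsPackingChromaticNumber G k =
  HasPackingColoring G k × (∀ j → HasPackingColoring G j → k ≤ j)

IsIndependent : ∀ {n} → Graph n → Subset n → Set
IsIndependent G S = ∀ u v → u ∈ S → v ∈ S → ¬ Adj G u v

IsIndependenceNumber : ∀ {n} → Graph n → ℕ → Set
IsIndependenceNumber {n} G a =
  (Σ (Subset n) λ S → IsIndependent G S × ∣ S ∣ ≡ a)
  × (∀ S → IsIndependent G S → ∣ S ∣ ≤ a)

degree : ∀ {n} → Graph n → Fin n → ℕ
degree G v = ∣ tabulate (adj G v) ∣

IsMaxDegree : ∀ {n} → Graph n → ℕ → Set
IsMaxDegree {n} G d = (Σ (Fin n) λ v → degree G v ≡ d) × (∀ v → degree G v ≤ d)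

module Submission where

-- Let w be a vertex of maximum degree and N[w] its closed
-- neighbourhood, of size Δ + 1.  Any two vertices of N[w] are at distance
-- at most 2, so every colour class V_i with i ≥ 2 meets N[w] in at most one
-- vertex, while V_1 ∩ N[w] is independent and has at most α vertices.
-- Splitting N[w] along V_1 gives Δ + 1 ≤ α + (χ_ρ − 1).
--
-- Colouring a maximum independent set with colour 1 and every
-- other vertex with its own colour is a packing colouring, so
-- χ_ρ ≤ 1 + (n − α).  When Δ = n − 1 this meets the lower bound.

open import Defs
open import Data.Nat using (ℕ; zero; suc; _+_; _∸_; _≤_; z≤n; s≤s)
open import Data.Nat.Properties
  using (+-comm; +-suc; ≤-refl; ≤-trans; ≤-antisym; +-mono-≤; +-monoˡ-≤; m∸n+n≡m; module ≤-Reasoning)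
open import Data.Bool using (Bool; true; false)
open import Data.Fin using (Fin; zero; suc; toℕ; _≟_; punchOut)
open import Data.Fin.Properties using (injective⇒≤; punchOut-injective; suc-injective)
open import Data.Fin.Subset using (Subset; _∈_; _∉_; ∣_∣; ⁅_⁆; _∪_; _∩_; ∁; inside; outside)
open import Data.Fin.Subset.Properties
  using (_∈?_; ∣p∣≤n; ∣∁p∣≡n∸∣p∣; x∈⁅y⁆⇒x≡y; x∈p∪q⁻; x∈p∩q⁻;
         x∉p⇒x∈∁p; x∈∁p⇒x∉p; p∩q⊆q; ∪-identityˡ)
open import Data.Vec using ([]; _∷_; here; there; tabulate)
open import Data.Vec.Properties using (lookup∘tabulate; []=⇒lookup; lookup⇒[]=)
open import Data.Product using (_×_; _,_; proj₁; proj₂)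
open import Data.Sum using (_⊎_; inj₁; inj₂)
open import Data.Empty using (⊥-elim)
open import Relation.Nullary using (¬_; Dec; yes; no)
open import Relation.Nullary.Decidable using (⌊_⌋)
open import Relation.Binary.PropositionalEquality
  using (_≡_; _≢_; refl; cong; subst; trans; module ≡-Reasoning)
  renaming (sym to ≡-sym)

enumerate : ∀ {m} (T : Subset m) → Fin ∣ T ∣ → Fin m
enumerate (true  ∷ T) zero    = zero
enumerate (true  ∷ T) (suc i) = suc (enumerate T i)
enumerate (false ∷ T) i       = suc (enumerate T i)

enumerate-∈ : ∀ {m} (T : Subset m) i → enumerate T i ∈ T
enumerate-∈ (true  ∷ T) zero    = here
enumerate-∈ (true  ∷ T) (suc i) = there (enumerate-∈ T i)
enumerate-∈ (false ∷ T) i       = there (enumerate-∈ T i)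

enumerate-injective : ∀ {m} (T : Subset m) {i j} → enumerate T i ≡ enumerate T j → i ≡ j
enumerate-injective (true  ∷ T) {zero}  {zero}  _ = refl
enumerate-injective (true  ∷ T) {suc i} {suc j} e = cong suc (enumerate-injective T (suc-injective e))
enumerate-injective (false ∷ T)                 e = enumerate-injective T (suc-injective e)

rank : ∀ {m} {T : Subset m} {x} → x ∈ T → Fin ∣ T ∣
rank                     here      = zero
rank {T = true  ∷ T} (there x∈T) = suc (rank x∈T)
rank {T = false ∷ T} (there x∈T) = rank x∈T

enumerate-rank : ∀ {m} {T : Subset m} {x} (x∈T : x ∈ T) → enumerate T (rank x∈T) ≡ x
enumerate-rank                     here      = refl
enumerate-rank {T = true  ∷ T} (there x∈T) = cong suc (enumerate-rank x∈T)
enumerate-rank {T = false ∷ T} (there x∈T) = cong suc (enumerate-rank x∈T)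

rank-injective : ∀ {m} {T : Subset m} {x y} (x∈T : x ∈ T) (y∈T : y ∈ T) →
  rank x∈T ≡ rank y∈T → x ≡ y
rank-injective {T = T} {x} {y} x∈T y∈T e = begin
  x                          ≡⟨ enumerate-rank x∈T ⟨
  enumerate T (rank x∈T)     ≡⟨ cong (enumerate T) e ⟩
  enumerate T (rank y∈T)     ≡⟨ enumerate-rank y∈T ⟩
  y                          ∎
  where open ≡-Reasoning

∣T∣≤-by-injection : ∀ {m k} (T : Subset m) (f : ∀ x → x ∈ T → Fin k) →
  (∀ x y x∈T y∈T → f x x∈T ≡ f y y∈T → x ≡ y) → ∣ T ∣ ≤ k
∣T∣≤-by-injection T f f-inj =
  injective⇒≤ {f = λ i → f (enumerate T i) (enumerate-∈ T i)}
    (λ e → enumerate-injective T (f-inj _ _ _ _ e))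

∣p∣≡∣p∩q∣+∣p∩∁q∣ : ∀ {m} (p q : Subset m) → ∣ p ∣ ≡ ∣ p ∩ q ∣ + ∣ p ∩ ∁ q ∣
∣p∣≡∣p∩q∣+∣p∩∁q∣ []            []            = refl
∣p∣≡∣p∩q∣+∣p∩∁q∣ (outside ∷ p) (_       ∷ q) = ∣p∣≡∣p∩q∣+∣p∩∁q∣ p q
∣p∣≡∣p∩q∣+∣p∩∁q∣ (inside  ∷ p) (inside  ∷ q) = cong suc (∣p∣≡∣p∩q∣+∣p∩∁q∣ p q)
∣p∣≡∣p∩q∣+∣p∩∁q∣ (inside  ∷ p) (outside ∷ q) =
  trans (cong suc (∣p∣≡∣p∩q∣+∣p∩∁q∣ p q)) (≡-sym (+-suc ∣ p ∩ q ∣ ∣ p ∩ ∁ q ∣))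

∣⁅x⁆∪p∣≡1+∣p∣ : ∀ {m} (x : Fin m) (p : Subset m) → x ∉ p → ∣ ⁅ x ⁆ ∪ p ∣ ≡ suc ∣ p ∣
∣⁅x⁆∪p∣≡1+∣p∣ zero    (inside  ∷ p) x∉p = ⊥-elim (x∉p here)
∣⁅x⁆∪p∣≡1+∣p∣ zero    (outside ∷ p) x∉p = cong (λ q → suc ∣ q ∣) (∪-identityˡ p)
∣⁅x⁆∪p∣≡1+∣p∣ (suc x) (inside  ∷ p) x∉p =
  cong suc (∣⁅x⁆∪p∣≡1+∣p∣ x p (λ x∈p → x∉p (there x∈p)))
∣⁅x⁆∪p∣≡1+∣p∣ (suc x) (outside ∷ p) x∉p =
  ∣⁅x⁆∪p∣≡1+∣p∣ x p (λ x∈p → x∉p (there x∈p))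

∈-tabulate⁺ : ∀ {m} (f : Fin m → Bool) {x} → f x ≡ true → x ∈ tabulate f
∈-tabulate⁺ f {x} fx = lookup⇒[]= x _ (trans (lookup∘tabulate f x) fx)

∈-tabulate⁻ : ∀ {m} (f : Fin m → Bool) {x} → x ∈ tabulate f → f x ≡ true
∈-tabulate⁻ f {x} x∈ = trans (≡-sym (lookup∘tabulate f x)) ([]=⇒lookup x∈)

Adj⇒≢ : ∀ {m} (G : Graph m) {u v} → Adj G u v → u ≢ v
Adj⇒≢ G {u} uv refl with trans (≡-sym uv) (irrefl G u)
... | ()

Adj-sym : ∀ {m} (G : Graph m) {u v} → Adj G u v → Adj G v u
Adj-sym G {u} {v} uv = trans (≡-sym (Graph.sym G u v)) uv

Adj⇒DistLe1 : ∀ {m} (G : Graph m) {u v} → Adj G u v → DistLe G u v 1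
Adj⇒DistLe1 G {v = v} uv = 1 , ≤-refl , (v , uv , refl)

DistLe1⇒Adj : ∀ {m} (G : Graph m) {u v} → u ≢ v → DistLe G u v 1 → Adj G u v
DistLe1⇒Adj G u≢v (zero          , _       , u≡v)           = ⊥-elim (u≢v u≡v)
DistLe1⇒Adj G u≢v (suc zero      , _       , (_ , uv , refl)) = uv
DistLe1⇒Adj G u≢v (suc (suc _)   , s≤s () , _)

neighbourhood : ∀ {m} → Graph m → Fin m → Subset m
neighbourhood G w = tabulate (adj G w)

closedNeighbourhood : ∀ {m} → Graph m → Fin m → Subset m
closedNeighbourhood G w = ⁅ w ⁆ ∪ neighbourhood G w

∣N[w]∣≡1+deg : ∀ {m} (G : Graph m) w → ∣ closedNeighbourhood G w ∣ ≡ suc (degree G w)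
∣N[w]∣≡1+deg G w = ∣⁅x⁆∪p∣≡1+∣p∣ w (neighbourhood G w) w∉N[w]
  where
  w∉N[w] : w ∉ neighbourhood G w
  w∉N[w] w∈ with trans (≡-sym (∈-tabulate⁻ (adj G w) w∈)) (irrefl G w)
  ... | ()

∈N[w]⁻ : ∀ {m} (G : Graph m) w {x} → x ∈ closedNeighbourhood G w → x ≡ w ⊎ Adj G w x
∈N[w]⁻ G w x∈ with x∈p∪q⁻ ⁅ w ⁆ (neighbourhood G w) x∈
... | inj₁ x∈⁅w⁆ = inj₁ (x∈⁅y⁆⇒x≡y w x∈⁅w⁆)
... | inj₂ x∈N   = inj₂ (∈-tabulate⁻ (adj G w) x∈N)

N[w]-diameter≤2 : ∀ {m} (G : Graph m) w {u v} →
  u ∈ closedNeighbourhood G w → v ∈ closedNeighbourhood G w → DistLe G u v 2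
N[w]-diameter≤2 G w {u} {v} u∈ v∈ with ∈N[w]⁻ G w u∈ | ∈N[w]⁻ G w v∈
... | inj₁ refl | inj₁ refl = 0 , z≤n , refl
... | inj₁ refl | inj₂ wv   = 1 , s≤s z≤n , (v , wv , refl)
... | inj₂ wu   | inj₁ refl = 1 , s≤s z≤n , (w , Adj-sym G wu , refl)
... | inj₂ wu   | inj₂ wv   = 2 , ≤-refl , (w , Adj-sym G wu , (v , wv , refl))

DistLe-mono : ∀ {m} (G : Graph m) {u v i j} → i ≤ j → DistLe G u v i → DistLe G u v j
DistLe-mono G i≤j (d , d≤i , walk) = d , ≤-trans d≤i i≤j , walk

∈-classOf⁺ : ∀ {m k} (c : Fin m → Fin k) {j u} → c u ≡ j → u ∈ classOf c j
∈-classOf⁺ c {j} {u} cu≡j = ∈-tabulate⁺ (λ v → ⌊ c v ≟ j ⌋) decided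
  where
  decided : ⌊ c u ≟ j ⌋ ≡ true
  decided with c u ≟ j
  ... | yes _    = refl
  ... | no cu≢j = ⊥-elim (cu≢j cu≡j)

∈-classOf⁻ : ∀ {m k} (c : Fin m → Fin k) {j u} → u ∈ classOf c j → c u ≡ j
∈-classOf⁻ c {j} {u} u∈ with c u ≟ j | ∈-tabulate⁻ (λ v → ⌊ c v ≟ j ⌋) u∈
... | yes cu≡j | _ = cu≡j

SameColourFar : ∀ {m k} → Graph m → (Fin m → Fin k) → Set
SameColourFar G c = ∀ u v → c u ≡ c v → u ≢ v → ¬ DistLe G u v (suc (toℕ (c u)))

packing⇒sameColourFar : ∀ {m k} (G : Graph m) (c : Fin m → Fin k) →
  IsPackingColoring G c → SameColourFar G c
packing⇒sameColourFar G c P u v cu≡cv =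
  P (c u) u v (∈-classOf⁺ c refl) (∈-classOf⁺ c (≡-sym cu≡cv))

sameColourFar⇒packing : ∀ {m k} (G : Graph m) (c : Fin m → Fin k) →
  SameColourFar G c → IsPackingColoring G c
sameColourFar⇒packing G c far j u v u∈ v∈ u≢v
  with ∈-classOf⁻ c u∈ | ∈-classOf⁻ c v∈
... | refl | cv≡cu = far u v (≡-sym cv≡cu) u≢v

-- Every colour other than the first forbids distance 2 inside its class.
2≤packingDistance : ∀ {k} {x : Fin (suc k)} → zero ≢ x → 2 ≤ suc (toℕ x)
2≤packingDistance {x = zero}  0≢0 = ⊥-elim (0≢0 refl)
2≤packingDistance {x = suc _} _   = s≤s (s≤s z≤n)

firstClass-independent : ∀ {m k} (G : Graph m) (c : Fin m → Fin (suc k)) →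
  IsPackingColoring G c → IsIndependent G (classOf c zero)
firstClass-independent G c P u v u∈ v∈ uv = P zero u v u∈ v∈ (Adj⇒≢ G uv) (Adj⇒DistLe1 G uv)

module _ {m k} (G : Graph m) (c : Fin m → Fin (suc k)) (P : IsPackingColoring G c) (w : Fin m) where

  private
    N : Subset m
    N = closedNeighbourhood G w

    V₁ : Subset m
    V₁ = classOf c zero

  N[w]∩V₁-independent : IsIndependent G (N ∩ V₁)
  N[w]∩V₁-independent u v u∈ v∈ =
    firstClass-independent G c P u v (p∩q⊆q N V₁ u∈) (p∩q⊆q N V₁ v∈)

  -- Every colour other than the first occurs at most once in N[w], so
  -- "colour minus one" injects N[w] ∖ V₁ into Fin k.
  ∣N[w]∖V₁∣≤k : ∣ N ∩ ∁ V₁ ∣ ≤ k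
  ∣N[w]∖V₁∣≤k = ∣T∣≤-by-injection (N ∩ ∁ V₁) higherColour higherColour-injective
    where
    notFirst : ∀ {u} → u ∈ N ∩ ∁ V₁ → zero ≢ c u
    notFirst u∈ 0≡cu = x∈∁p⇒x∉p (proj₂ (x∈p∩q⁻ N (∁ V₁) u∈)) (∈-classOf⁺ c (≡-sym 0≡cu))

    higherColour : ∀ u → u ∈ N ∩ ∁ V₁ → Fin k
    higherColour u u∈ = punchOut (notFirst u∈)

    higherColour-injective : ∀ u v u∈ v∈ → higherColour u u∈ ≡ higherColour v v∈ → u ≡ v
    higherColour-injective u v u∈ v∈ e with u ≟ v
    ... | yes u≡v = u≡v
    ... | no u≢v  = ⊥-elim (packing⇒sameColourFar G c P u v cu≡cv u≢v
                      (DistLe-mono G (2≤packingDistance (notFirst u∈))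
                        (N[w]-diameter≤2 G w (inN u∈) (inN v∈))))
      where
      cu≡cv : c u ≡ c v
      cu≡cv = punchOut-injective (notFirst u∈) (notFirst v∈) e

      inN : ∀ {x} → x ∈ N ∩ ∁ V₁ → x ∈ N
      inN x∈ = proj₁ (x∈p∩q⁻ N (∁ V₁) x∈)

  degree+2≤colours+α : ∀ a → (∀ S → IsIndependent G S → ∣ S ∣ ≤ a) →
    degree G w + 2 ≤ suc k + a
  degree+2≤colours+α a α-bound = begin
    degree G w + 2                 ≡⟨ +-comm (degree G w) 2 ⟩
    suc (suc (degree G w))         ≡⟨ cong suc (∣N[w]∣≡1+deg G w) ⟨
    suc ∣ N ∣                      ≡⟨ cong suc (∣p∣≡∣p∩q∣+∣p∩∁q∣ N V₁) ⟩
    suc (∣ N ∩ V₁ ∣ + ∣ N ∩ ∁ V₁ ∣)  ≤⟨ s≤s (+-mono-≤ (α-bound _ N[w]∩V₁-independent) ∣N[w]∖V₁∣≤k) ⟩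
    suc (a + k)                    ≡⟨ cong suc (+-comm a k) ⟩
    suc k + a                      ∎
    where open ≤-Reasoning

-- The same bound for an arbitrary number of colours (zero colours cannot
-- colour the vertex w).
degree+2≤χ+α : ∀ {m χ} (G : Graph m) (w : Fin m) a → HasPackingColoring G χ →
  (∀ S → IsIndependent G S → ∣ S ∣ ≤ a) → degree G w + 2 ≤ χ + a
degree+2≤χ+α {χ = zero}  G w a (c , _) _ with c w
... | ()
degree+2≤χ+α {χ = suc _} G w a (c , P) α-bound = degree+2≤colours+α G c P w a α-bound

module _ {m} (G : Graph m) (S : Subset m) (S-independent : IsIndependent G S) where

  colourBy : (u : Fin m) → Dec (u ∈ S) → Fin (suc ∣ ∁ S ∣)
  colourBy u (yes _)   = zero
  colourBy u (no u∉S) = suc (rank (x∉p⇒x∈∁p u∉S))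

  sameColour : ∀ {u v} (u∈? : Dec (u ∈ S)) (v∈? : Dec (v ∈ S)) →
    colourBy u u∈? ≡ colourBy v v∈? → u ≡ v ⊎ (u ∈ S × v ∈ S × colourBy u u∈? ≡ zero)
  sameColour (yes u∈S) (yes v∈S) _ = inj₂ (u∈S , v∈S , refl)
  sameColour (yes _)   (no _)    ()
  sameColour (no _)    (yes _)   ()
  sameColour (no u∉S)  (no v∉S)  e =
    inj₁ (rank-injective (x∉p⇒x∈∁p u∉S) (x∉p⇒x∈∁p v∉S) (suc-injective e))

  independentSet-colouring : HasPackingColoring G (suc ∣ ∁ S ∣)
  independentSet-colouring = colour , sameColourFar⇒packing G colour far
    where
    colour : Fin m → Fin (suc ∣ ∁ S ∣)
    colour u = colourBy u (u ∈? S)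

    far : SameColourFar G colour
    far u v cu≡cv u≢v dist with sameColour (u ∈? S) (v ∈? S) cu≡cv
    ... | inj₁ u≡v               = u≢v u≡v
    ... | inj₂ (u∈S , v∈S , cu≡0) =
      S-independent u v u∈S v∈S
        (DistLe1⇒Adj G u≢v (subst (λ x → DistLe G u v (suc (toℕ x))) cu≡0 dist))

χ+α≤order+1 : ∀ {m} (G : Graph m) χ a →
  IsPackingChromaticNumber G χ → IsIndependenceNumber G a → χ + a ≤ suc m
χ+α≤order+1 {m} G χ a (_ , minimal) ((S , S-independent , ∣S∣≡a) , _) = begin
  χ + a                 ≤⟨ +-monoˡ-≤ a (minimal _ (independentSet-colouring G S S-independent)) ⟩
  suc ∣ ∁ S ∣ + a        ≡⟨ cong (λ s → suc s + a) (∣∁p∣≡n∸∣p∣ S) ⟩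
  suc (m ∸ ∣ S ∣ + a)    ≡⟨ cong (λ s → suc (m ∸ s + a)) ∣S∣≡a ⟩
  suc (m ∸ a + a)       ≡⟨ cong suc (m∸n+n≡m (subst (_≤ m) ∣S∣≡a (∣p∣≤n S))) ⟩
  suc m                 ∎
  where open ≤-Reasoning

proposition4p1 : (n : ℕ) (G : Graph (suc n)) (χ a d : ℕ) →
    IsPackingChromaticNumber G χ → IsIndependenceNumber G a → IsMaxDegree G d →
    (d + 2 ≤ χ + a) × (d ≡ n → χ + a ≡ d + 2)
proposition4p1 n G χ a d χ-def@(colouring , _) α-def@(_ , α-bound) ((w , deg-w≡d) , _) =
  lower , upper
  where
  lower : d + 2 ≤ χ + a
  lower = subst (λ x → x + 2 ≤ χ + a) deg-w≡d (degree+2≤χ+α G w a colouring α-bound)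

  -- with Δ = n(G) − 1 the upper bound n(G) + 1 equals Δ + 2
  upper : d ≡ n → χ + a ≡ d + 2
  upper refl = ≤-antisym (subst (χ + a ≤_) (+-comm 2 d) (χ+α≤order+1 G χ a χ-def α-def)) lower
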